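{- For each $\theta\in[0,1]$ there exists an asymptotically $2$-automatic sequence $\mathbf a=(a_n)_{n=0}^\infty$ over the alphabet $\{0,1\}$ such that the frequency of $1$ in $\mathbf a$ exists and equals $\theta$, i.e. $\lim_{N\to\infty}\frac1N\#\{0\le n<N: a_n=1\}=\theta$.
   Context: For a sequence $\mathbf a=(a_n)_{n\ge0}$ and an integer $k\ge2$, the $k$-kernel of $\mathbf a$ is $\mathcal N_k(\mathbf a)=\{(a_{k^in+r})_{n=0}^\infty : i,r\in\mathbb N_0,\ r<k^i\}$. Two sequences $\mathbf a,\mathbf b$ are asymptotically equal, $\mathbf a\simeq\mathbf b$, if $\frac1N\#\{0\le n<N: a_n\ne b_n\}\to0$. A sequence over a finite alphabet is asymptotically $k$-automatic if $\mathcal N_k(\mathbf a)$ is finite up to $\simeq$ (finitely many sequences such that each kernel element is asymptotically equal to one of them). -}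

module Defs where

open import Data.Nat using (ℕ; zero; suc; _+_; _*_; _^_; _≤_; _<_)
open import Data.Bool using (Bool; true; false; if_then_else_)
open import Data.Product using (Σ; ∃; _×_)
open import Data.List using (List)
open import Data.List.Relation.Unary.Any using (Any)
open import Relation.Binary.PropositionalEquality using (_≡_; _≢_)
open import Relation.Nullary using (Dec; yes; no)
open import Data.Bool.Properties using () renaming (_≟_ to _≟B_)

-- A sequence over the alphabet {0,1}; `true` encodes the letter 1, `false` the letter 0.
Seq : Set
Seq = ℕ → Bool

count1 : Seq → ℕ → ℕ
count1 a zero    = 0
count1 a (suc N) = count1 a N + (if a N then 1 else 0)

mismatch : Seq → Seq → ℕ → ℕ
mismatch a b zero    = 0
mismatch a b (suc N) with a N ≟B b N
... | yes _ = mismatch a b N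
... | no  _ = suc (mismatch a b N)

-- Asymptotic equality: (1/N) #{n < N : a n ≠ b n} → 0,
-- i.e. for every k, eventually mismatch(N) ≤ 2^{-k} · N.
_≃_ : Seq → Seq → Set
a ≃ b = ∀ (k : ℕ) → ∃ λ N₀ → ∀ N → N₀ ≤ N → mismatch a b N * 2 ^ k ≤ N

kernelSeq : Seq → ℕ → ℕ → Seq
kernelSeq a i r n = a (2 ^ i * n + r)

AsympAutomatic2 : Seq → Set
AsympAutomatic2 a =
  Σ (List Seq) λ L → ∀ (i r : ℕ) → r < 2 ^ i → Any (λ b → kernelSeq a i r ≃ b) L

-- A real θ ∈ [0,1] is represented by a binary expansion d : ℕ → Bool,
-- θ = Σ_{i ≥ 0} d_i 2^{-(i+1)}  (every θ ∈ [0,1] has such an expansion; 1 = 0.111…).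
-- trunc d k = Σ_{i<k} d_i 2^{k-1-i}, so that s_k = trunc d k / 2^k satisfies
-- s_k ≤ θ ≤ s_k + 2^{-k}.
trunc : (ℕ → Bool) → ℕ → ℕ
trunc d zero    = 0
trunc d (suc k) = 2 * trunc d k + (if d k then 1 else 0)

-- The frequency of 1 in a exists and equals θ (given by digits d):
-- for each k, eventually  s_k − 2^{-k} ≤ count1(N)/N ≤ s_k + 2·2^{-k}
-- (cleared of denominators). Since |s_k − θ| ≤ 2^{-k}, this is equivalent to
-- count1(N)/N → θ.
FreqOneEq : Seq → (ℕ → Bool) → Set
FreqOneEq a d = ∀ (k : ℕ) → ∃ λ N₀ → ∀ N → N₀ ≤ N →
  (trunc d k * N ≤ count1 a N * 2 ^ k + N) ×
  (count1 a N * 2 ^ k ≤ (trunc d k + 2) * N)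

-- The sequence is a concatenation of dyadic blocks, the block of level L filling the positions
-- [2^L, 2^(L+1)). A block repeats the 2^m-periodic word with trunc d m ones at the start of each
-- period, whose density is within 2^(-m) of θ, where m ≈ L − log₂ L: writing L + 1 = 2^K + t with
-- t < 2^K, the block uses m = L − K − 1 on its first t·2^(m+1) positions and m + 1 on the rest.
-- The (m+1)-word at 2j+e agrees with the m-word at j unless j lies in one residue class modulo 2^m,
-- and the switch point moves by only 2^(m+1) from one level to the next, so a(2n+e) and a(n) differ
-- on a set of density O(2^(−K)): every element of the 2-kernel is asymptotically equal to a itself.
-- For fixed k, all levels with K ≥ k + 3 have their frequency of ones within 2^(−k) of trunc d k / 2^k.
module Submission where

open import Defs
open import Data.Nat
open import Data.Nat.Properties
open import Data.Bool using (Bool; true; false; if_then_else_; T; _∨_; _∧_; _xor_)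
open import Data.Bool.Properties using (xor-same; if-float; T-∨; T-∧) renaming (_≟_ to _≟B_)
open import Data.List using (_∷_; [])
open import Data.List.Relation.Unary.Any using (here)
open import Data.Empty using (⊥-elim)
open import Relation.Nullary using (¬_; Dec; yes; no)
open import Relation.Nullary.Reflects using (ofʸ; ofⁿ)
open import Data.Product using (Σ; ∃; ∃₂; _×_; _,_; proj₁; proj₂)
open import Data.Nat.Logarithm
open import Data.Nat.DivMod
open import Relation.Binary.Definitions using (tri<; tri≈; tri>)
open import Data.Sum using (_⊎_; inj₁; inj₂)
open import Function.Bundles using (Equivalence)
open import Relation.Binary.PropositionalEquality
open import Data.Nat.Tactic.RingSolver using (solve-∀)

bit : Bool → ℕ
bit b = if b then 1 else 0

bit≤1 : ∀ b → bit b ≤ 1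
bit≤1 true  = ≤-refl
bit≤1 false = z≤n

bit-mono : ∀ x y → (T x → T y) → bit x ≤ bit y
bit-mono false y     _ = z≤n
bit-mono true  true  _ = ≤-refl
bit-mono true  false h = ⊥-elim (h _)

bit-∨ : ∀ x y → bit (x ∨ y) ≤ bit x + bit y
bit-∨ true  y = s≤s z≤n
bit-∨ false y = ≤-refl

count1-cong : ∀ {f g} N → (∀ n → n < N → f n ≡ g n) → count1 f N ≡ count1 g N
count1-cong zero    _ = refl
count1-cong (suc N) h =
  cong₂ _+_ (count1-cong N (λ n n<N → h n (m<n⇒m<1+n n<N))) (cong bit (h N ≤-refl))

count1-zero : ∀ {f} N → (∀ n → n < N → f n ≡ false) → count1 f N ≡ 0
count1-zero zero    _ = refl
count1-zero (suc N) h
  rewrite h N ≤-refl = trans (+-identityʳ _) (count1-zero N (λ n n<N → h n (m<n⇒m<1+n n<N)))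

count1-+ : ∀ f m n → count1 f (m + n) ≡ count1 f m + count1 (λ i → f (m + i)) n
count1-+ f m zero    = trans (cong (count1 f) (+-identityʳ m)) (sym (+-identityʳ _))
count1-+ f m (suc n) rewrite +-suc m n | count1-+ f m n = +-assoc (count1 f m) _ _

count1-≤ : ∀ f N → count1 f N ≤ N
count1-≤ f zero    = z≤n
count1-≤ f (suc N) = ≤-trans (+-mono-≤ (count1-≤ f N) (bit≤1 (f N))) (≤-reflexive (+-comm N 1))

count1-mono : ∀ f {M N} → M ≤ N → count1 f M ≤ count1 f N
count1-mono f {M} {N} M≤N = begin
  count1 f M                                      ≤⟨ m≤m+n _ _ ⟩
  count1 f M + count1 (λ i → f (M + i)) (N ∸ M)   ≡⟨ sym (count1-+ f M (N ∸ M)) ⟩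
  count1 f (M + (N ∸ M))                          ≡⟨ cong (count1 f) (m+[n∸m]≡n M≤N) ⟩
  count1 f N                                      ∎
  where open ≤-Reasoning

count1-⇒ : ∀ {f g} N → (∀ n → n < N → T (f n) → T (g n)) → count1 f N ≤ count1 g N
count1-⇒ zero    _ = z≤n
count1-⇒ {f} {g} (suc N) h =
  +-mono-≤ (count1-⇒ N (λ n n<N → h n (m<n⇒m<1+n n<N))) (bit-mono (f N) (g N) (h N ≤-refl))

count1-∨ : ∀ f g N → count1 (λ n → f n ∨ g n) N ≤ count1 f N + count1 g N
count1-∨ f g zero    = z≤n
count1-∨ f g (suc N) = begin
  count1 (λ n → f n ∨ g n) N + bit (f N ∨ g N)        ≤⟨ +-mono-≤ (count1-∨ f g N) (bit-∨ (f N) (g N)) ⟩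
  (count1 f N + count1 g N) + (bit (f N) + bit (g N)) ≡⟨ +-interchange (count1 f N) _ _ _ ⟩
  (count1 f N + bit (f N)) + (count1 g N + bit (g N)) ∎
  where
  open ≤-Reasoning
  +-interchange : ∀ a b c d → (a + b) + (c + d) ≡ (a + c) + (b + d)
  +-interchange = solve-∀

count1-window : ∀ f A W N → (∀ n → T (f n) → A ≤ n × n < A + W) → count1 f N ≤ W
count1-window f A W N h = begin
  count1 f N                        ≤⟨ count1-mono f (m≤n+m N (A + W)) ⟩
  count1 f ((A + W) + N)            ≡⟨ count1-+ f (A + W) N ⟩
  count1 f (A + W) + count1 _ N     ≡⟨ cong (count1 f (A + W) +_) (count1-zero N beyond) ⟩
  count1 f (A + W) + 0              ≡⟨ +-identityʳ _ ⟩
  count1 f (A + W)                  ≡⟨ count1-+ f A W ⟩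
  count1 f A + count1 _ W           ≡⟨ cong (_+ count1 (λ i → f (A + i)) W) (count1-zero A before) ⟩
  count1 (λ i → f (A + i)) W        ≤⟨ count1-≤ _ W ⟩
  W                                 ∎
  where
  open ≤-Reasoning
  outside : ∀ n → ¬ T (f n) → f n ≡ false
  outside n ¬fn with f n
  ... | true  = ⊥-elim (¬fn _)
  ... | false = refl
  before : ∀ n → n < A → f n ≡ false
  before n n<A = outside n (λ fn → <⇒≱ n<A (proj₁ (h n fn)))
  beyond : ∀ i → i < N → f (A + W + i) ≡ false
  beyond i _ = outside _ (λ fn → m+n≮m (A + W) i (proj₂ (h _ fn)))

count1-periodic : ∀ f p → (∀ i → f (p + i) ≡ f i) → ∀ c x → count1 f (c * p + x) ≡ c * count1 f p + count1 f x
count1-periodic f p per zero    x = refl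
count1-periodic f p per (suc c) x = begin
  count1 f (p + c * p + x)                              ≡⟨ cong (count1 f) (+-assoc p (c * p) x) ⟩
  count1 f (p + (c * p + x))                            ≡⟨ count1-+ f p (c * p + x) ⟩
  count1 f p + count1 (λ i → f (p + i)) (c * p + x)     ≡⟨ cong (count1 f p +_) (count1-cong (c * p + x) (λ i _ → per i)) ⟩
  count1 f p + count1 f (c * p + x)                     ≡⟨ cong (count1 f p +_) (count1-periodic f p per c x) ⟩
  count1 f p + (c * count1 f p + count1 f x)            ≡⟨ sym (+-assoc (count1 f p) _ _) ⟩
  suc c * count1 f p + count1 f x                       ∎
  where open ≡-Reasoning

<ᵇ≡true : ∀ {m n} → m < n → (m <ᵇ n) ≡ true
<ᵇ≡true {m} {n} m<n with m <ᵇ n | <ᵇ-reflects-< m n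
... | true  | _       = refl
... | false | ofⁿ m≮n = ⊥-elim (m≮n m<n)

<ᵇ≡false : ∀ {m n} → ¬ m < n → (m <ᵇ n) ≡ false
<ᵇ≡false {m} {n} m≮n with m <ᵇ n | <ᵇ-reflects-< m n
... | false | _       = refl
... | true  | ofʸ m<n = ⊥-elim (m≮n m<n)

count1-<ᵇ : ∀ B n → count1 (λ i → i <ᵇ B) n ≡ n ⊓ B
count1-<ᵇ B zero    = refl
count1-<ᵇ B (suc n) with n <ᵇ B | <ᵇ-reflects-< n B
... | true  | ofʸ n<B
  rewrite count1-<ᵇ B n | m≤n⇒m⊓n≡m (<⇒≤ n<B) | m≤n⇒m⊓n≡m n<B = +-comm n 1
... | false | ofⁿ n≮B
  rewrite count1-<ᵇ B n | m≥n⇒m⊓n≡n (≮⇒≥ n≮B) | m≥n⇒m⊓n≡n (m≤n⇒m≤1+n (≮⇒≥ n≮B)) = +-identityʳ B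

2^[1+n]≡2^n+2^n : ∀ n → 2 ^ suc n ≡ 2 ^ n + 2 ^ n
2^[1+n]≡2^n+2^n n = cong (2 ^ n +_) (+-identityʳ (2 ^ n))

2^n+m<2^[1+n] : ∀ n {m} → m < 2 ^ n → 2 ^ n + m < 2 ^ suc n
2^n+m<2^[1+n] n {m} m<2^n = subst (2 ^ n + m <_) (sym (2^[1+n]≡2^n+2^n n)) (+-monoʳ-< (2 ^ n) m<2^n)

⌊n/2⌋<m : ∀ n m → n < m + m → ⌊ n /2⌋ < m
⌊n/2⌋<m zero          (suc m) _ = z<s
⌊n/2⌋<m (suc zero)    (suc m) _ = z<s
⌊n/2⌋<m (suc (suc n)) (suc m) n<2m rewrite +-suc m m = s≤s (⌊n/2⌋<m n m (s<s⁻¹ (s<s⁻¹ n<2m)))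

2^L≤⌊n/2⌋ : ∀ L n → 2 ^ suc L ≤ n → 2 ^ L ≤ ⌊ n /2⌋
2^L≤⌊n/2⌋ L n 2^[1+L]≤n = begin
  2 ^ L                       ≡⟨ n≡⌊n+n/2⌋ (2 ^ L) ⟩
  ⌊ 2 ^ L + 2 ^ L /2⌋         ≡⟨ cong ⌊_/2⌋ (sym (2^[1+n]≡2^n+2^n L)) ⟩
  ⌊ 2 ^ suc L /2⌋             ≤⟨ ⌊n/2⌋-mono 2^[1+L]≤n ⟩
  ⌊ n /2⌋                     ∎
  where open ≤-Reasoning

⌊log₂⌋-≥ : ∀ {L n} → 2 ^ L ≤ n → L ≤ ⌊log₂ n ⌋
⌊log₂⌋-≥ {L} 2^L≤n = subst (_≤ _) (⌊log₂[2^n]⌋≡n L) (⌊log₂⌋-mono-≤ 2^L≤n)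

⌊log₂⌋-unique : ∀ L n → 2 ^ L ≤ n → n < 2 ^ suc L → ⌊log₂ n ⌋ ≡ L
⌊log₂⌋-unique zero    (suc zero)    _ _ = ⌊log₂[2^n]⌋≡n 0
⌊log₂⌋-unique zero    (suc (suc n)) _ (s<s (s<s ()))
⌊log₂⌋-unique (suc L) n lo hi = begin
  ⌊log₂ n ⌋             ≡⟨ sym (m+[n∸m]≡n 1≤log) ⟩
  1 + (⌊log₂ n ⌋ ∸ 1)   ≡⟨ cong suc (sym (⌊log₂⌊n/2⌋⌋≡⌊log₂n⌋∸1 n)) ⟩
  1 + ⌊log₂ ⌊ n /2⌋ ⌋   ≡⟨ cong suc (⌊log₂⌋-unique L ⌊ n /2⌋ (2^L≤⌊n/2⌋ L n lo) (⌊n/2⌋<m n (2 ^ suc L) hi′)) ⟩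
  suc L                 ∎
  where
  open ≡-Reasoning
  1≤log : 1 ≤ ⌊log₂ n ⌋
  1≤log = ≤-trans (s≤s z≤n) (⌊log₂⌋-≥ {suc L} lo)
  hi′ : n < 2 ^ suc L + 2 ^ suc L
  hi′ = subst (n <_) (2^[1+n]≡2^n+2^n (suc L)) hi

dyadic-interval : ∀ n → 0 < n → Σ ℕ λ L → 2 ^ L ≤ n × n < 2 ^ suc L
dyadic-interval (suc zero)    _ = 0 , s≤s z≤n , s≤s (s≤s z≤n)
dyadic-interval (suc (suc n)) _ with dyadic-interval (suc n) z<s
... | L , lo , hi with suc (suc n) <? 2 ^ suc L
...   | yes n<2^[1+L] = L , m≤n⇒m≤1+n lo , n<2^[1+L]
...   | no  n≮2^[1+L] = suc L , ≮⇒≥ n≮2^[1+L] , ≤-<-trans hi (^-monoʳ-< 2 (s≤s (s≤s z≤n)) (n<1+n (suc L)))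

⌊log₂⌋-bounds : ∀ n → 0 < n → 2 ^ ⌊log₂ n ⌋ ≤ n × n < 2 ^ suc ⌊log₂ n ⌋
⌊log₂⌋-bounds n 0<n with dyadic-interval n 0<n
... | L , lo , hi rewrite ⌊log₂⌋-unique L n lo hi = lo , hi

dyadic-split : ∀ L₀ N → 2 ^ L₀ ≤ N → ∃₂ λ L j → L₀ ≤ L × N ≡ 2 ^ L + j × j < 2 ^ L
dyadic-split L₀ N 2^L₀≤N = L , N ∸ 2 ^ L , ⌊log₂⌋-≥ 2^L₀≤N , sym (m+[n∸m]≡n lo) , j<2^L
  where
  L : ℕ
  L = ⌊log₂ N ⌋
  bounds : 2 ^ L ≤ N × N < 2 ^ suc L
  bounds = ⌊log₂⌋-bounds N (≤-trans (m^n>0 2 L₀) 2^L₀≤N)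
  lo : 2 ^ L ≤ N
  lo = proj₁ bounds
  j<2^L : N ∸ 2 ^ L < 2 ^ L
  j<2^L = +-cancelˡ-< (2 ^ L) _ _ (subst₂ _<_ (sym (m+[n∸m]≡n lo)) (2^[1+n]≡2^n+2^n L) (proj₂ bounds))

dyadicConcat : (ℕ → Seq) → Seq
dyadicConcat b n = b ⌊log₂ n ⌋ (n ∸ 2 ^ ⌊log₂ n ⌋)

dyadicConcat-block : ∀ b L j → j < 2 ^ L → dyadicConcat b (2 ^ L + j) ≡ b L j
dyadicConcat-block b L j j<2^L
  rewrite ⌊log₂⌋-unique L (2 ^ L + j) (m≤m+n _ j) (2^n+m<2^[1+n] L j<2^L) | m+n∸m≡n (2 ^ L) j = refl

induction-from : ∀ (P : ℕ → Set) {m} → P m → (∀ n → m ≤ n → P n → P (suc n)) → ∀ n → m ≤ n → P n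
induction-from P Pm step zero    z≤n = Pm
induction-from P {m} Pm step (suc n) m≤1+n with m ≤? n
... | yes m≤n = step n m≤n (induction-from P Pm step n m≤n)
... | no  m≰n = subst P (≤-antisym m≤1+n (≰⇒> m≰n)) Pm

Negligible : (ℕ → Bool) → Set
Negligible f = ∀ k → ∃ λ N₀ → ∀ N → N₀ ≤ N → count1 f N * 2 ^ k ≤ N

≤-halve-2^ : ∀ x k N → x * 2 ^ suc k ≤ 2 * N → x * 2 ^ k ≤ N
≤-halve-2^ x k N le = *-cancelˡ-≤ 2 (subst (_≤ 2 * N) (x*[2*y]≡2*[x*y] x (2 ^ k)) le)
  where
  x*[2*y]≡2*[x*y] : ∀ x y → x * (2 * y) ≡ 2 * (x * y)
  x*[2*y]≡2*[x*y] = solve-∀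

negligible-false : Negligible (λ _ → false)
negligible-false k = 0 , λ N _ → subst (λ c → c * 2 ^ k ≤ N) (sym (count1-zero N (λ _ _ → refl))) z≤n

negligible-⇒ : ∀ {f g} → (∀ n → T (f n) → T (g n)) → Negligible g → Negligible f
negligible-⇒ {f} {g} f⇒g neg k with neg k
... | N₀ , small = N₀ , λ N N₀≤N →
  ≤-trans (*-monoˡ-≤ (2 ^ k) (count1-⇒ N (λ n _ → f⇒g n))) (small N N₀≤N)

negligible-∨ : ∀ {f g} → Negligible f → Negligible g → Negligible (λ n → f n ∨ g n)
negligible-∨ {f} {g} negf negg k with negf (suc k) | negg (suc k)
... | N₁ , smallf | N₂ , smallg = N₁ + N₂ , λ N le →
  ≤-halve-2^ (count1 (λ n → f n ∨ g n) N) k N (begin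
    count1 (λ n → f n ∨ g n) N * 2 ^ suc k               ≤⟨ *-monoˡ-≤ (2 ^ suc k) (count1-∨ f g N) ⟩
    (count1 f N + count1 g N) * 2 ^ suc k                ≡⟨ *-distribʳ-+ (2 ^ suc k) (count1 f N) _ ⟩
    count1 f N * 2 ^ suc k + count1 g N * 2 ^ suc k      ≤⟨ +-mono-≤ (smallf N (≤-trans (m≤m+n N₁ N₂) le))
                                                                    (smallg N (≤-trans (m≤n+m N₂ N₁) le)) ⟩
    N + N                                                ≡⟨ cong (N +_) (sym (+-identityʳ N)) ⟩
    2 * N                                                ∎)
  where open ≤-Reasoning

count1-subsample : ∀ f e → e < 2 → ∀ N → count1 (λ n → f (2 * n + e)) N ≤ count1 f (2 * N)
count1-subsample f e e<2 zero    = z≤n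
count1-subsample f e e<2 (suc N) = begin
  count1 (λ n → f (2 * n + e)) N + bit (f (2 * N + e))     ≤⟨ +-mono-≤ (count1-subsample f e e<2 N) (one-of-two e e<2) ⟩
  count1 f (2 * N) + (bit (f (2 * N)) + bit (f (suc (2 * N)))) ≡⟨ sym (+-assoc (count1 f (2 * N)) _ _) ⟩
  count1 f (suc (suc (2 * N)))                               ≡⟨ cong (count1 f) (sym (2*[1+n]≡2+2*n N)) ⟩
  count1 f (2 * suc N)                                       ∎
  where
  open ≤-Reasoning
  2*[1+n]≡2+2*n : ∀ n → 2 * suc n ≡ suc (suc (2 * n))
  2*[1+n]≡2+2*n = solve-∀
  one-of-two : ∀ e → e < 2 → bit (f (2 * N + e)) ≤ bit (f (2 * N)) + bit (f (suc (2 * N)))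
  one-of-two zero          _ rewrite +-identityʳ (2 * N) = m≤m+n _ _
  one-of-two (suc zero)    _ rewrite +-comm (2 * N) 1   = m≤n+m _ _
  one-of-two (suc (suc e)) (s<s (s<s ()))

negligible-subsample : ∀ {f} e → e < 2 → Negligible f → Negligible (λ n → f (2 * n + e))
negligible-subsample {f} e e<2 neg k with neg (suc k)
... | N₀ , small = N₀ , λ N N₀≤N →
  ≤-halve-2^ (count1 (λ n → f (2 * n + e)) N) k N (≤-trans (*-monoˡ-≤ (2 ^ suc k) (count1-subsample f e e<2 N))
                       (small (2 * N) (≤-trans N₀≤N (m≤n*m N 2))))

negligible-dyadic : ∀ f →
  (∀ k → ∃ λ L₀ → ∀ L → L₀ ≤ L → count1 (λ j → f (2 ^ L + j)) (2 ^ L) * 2 ^ k ≤ 2 ^ L) →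
  Negligible f
negligible-dyadic f blocks k with blocks (2 + k)
... | L₀ , small = C , bound
  where
  q C : ℕ
  q = 2 ^ (2 + k)
  C = 2 ^ L₀ * q
  open ≤-Reasoning
  prefix : ∀ L → L₀ ≤ L → count1 f (2 ^ L) * q ≤ 2 ^ L + C
  prefix = induction-from (λ L → count1 f (2 ^ L) * q ≤ 2 ^ L + C)
    (≤-trans (*-monoˡ-≤ q (count1-≤ f (2 ^ L₀))) (m≤n+m C (2 ^ L₀)))
    λ L L₀≤L ih → begin
      count1 f (2 ^ suc L) * q                                  ≡⟨ cong (λ x → count1 f x * q) (2^[1+n]≡2^n+2^n L) ⟩
      count1 f (2 ^ L + 2 ^ L) * q                              ≡⟨ cong (_* q) (count1-+ f (2 ^ L) (2 ^ L)) ⟩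
      (count1 f (2 ^ L) + count1 (λ j → f (2 ^ L + j)) (2 ^ L)) * q ≡⟨ *-distribʳ-+ q (count1 f (2 ^ L)) _ ⟩
      count1 f (2 ^ L) * q + count1 (λ j → f (2 ^ L + j)) (2 ^ L) * q ≤⟨ +-mono-≤ ih (small L L₀≤L) ⟩
      2 ^ L + C + 2 ^ L                                         ≡⟨ x+c+x≡[x+x]+c (2 ^ L) C ⟩
      (2 ^ L + 2 ^ L) + C                                       ≡⟨ cong (_+ C) (sym (2^[1+n]≡2^n+2^n L)) ⟩
      2 ^ suc L + C                                             ∎
    where
    x+c+x≡[x+x]+c : ∀ x c → x + c + x ≡ (x + x) + c
    x+c+x≡[x+x]+c = solve-∀
  bound : ∀ N → C ≤ N → count1 f N * 2 ^ k ≤ N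
  bound N C≤N with dyadic-split L₀ N (≤-trans (m≤m*n (2 ^ L₀) q {{m^n≢0 2 (2 + k)}}) C≤N)
  ... | L , j , L₀≤L , refl , j<2^L = *-cancelˡ-≤ 4 (begin
    4 * (count1 f N * 2 ^ k)          ≡⟨ 4*[x*y]≡x*[4*y] (count1 f N) (2 ^ k) ⟩
    count1 f N * q                    ≤⟨ *-monoˡ-≤ q (count1-mono f N≤2^[1+L]) ⟩
    count1 f (2 ^ suc L) * q          ≤⟨ prefix (suc L) (m≤n⇒m≤1+n L₀≤L) ⟩
    2 ^ suc L + C                     ≤⟨ +-mono-≤ (≤-trans (≤-reflexive (2^[1+n]≡2^n+2^n L)) (+-mono-≤ 2^L≤N 2^L≤N)) C≤N ⟩
    N + N + N                         ≤⟨ m≤m+n (N + N + N) N ⟩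
    N + N + N + N                     ≡⟨ 4-fold N ⟩
    4 * N                             ∎)
    where
    2^L≤N : 2 ^ L ≤ N
    2^L≤N = m≤m+n (2 ^ L) j
    N≤2^[1+L] : N ≤ 2 ^ suc L
    N≤2^[1+L] = <⇒≤ (2^n+m<2^[1+n] L j<2^L)
    4*[x*y]≡x*[4*y] : ∀ x y → 4 * (x * y) ≡ x * (2 * (2 * y))
    4*[x*y]≡x*[4*y] = solve-∀
    4-fold : ∀ n → n + n + n + n ≡ 4 * n
    4-fold = solve-∀

xor-≢ : ∀ {x y} → x ≢ y → x xor y ≡ true
xor-≢ {true}  {true}  x≢y = ⊥-elim (x≢y refl)
xor-≢ {true}  {false} _   = refl
xor-≢ {false} {true}  _   = refl
xor-≢ {false} {false} x≢y = ⊥-elim (x≢y refl)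

xor-triangle : ∀ x y z → T (x xor z) → T ((x xor y) ∨ (y xor z))
xor-triangle true  true  false _ = _
xor-triangle true  false false _ = _
xor-triangle false true  true  _ = _
xor-triangle false false true  _ = _

mismatch≡count1-xor : ∀ a b N → mismatch a b N ≡ count1 (λ n → a n xor b n) N
mismatch≡count1-xor a b zero = refl
mismatch≡count1-xor a b (suc N) with a N ≟B b N
... | yes aN≡bN rewrite aN≡bN | xor-same (b N) = trans (mismatch≡count1-xor a b N) (sym (+-identityʳ _))
... | no  aN≢bN rewrite xor-≢ aN≢bN = trans (cong suc (mismatch≡count1-xor a b N)) (+-comm 1 _)

≃⇒negligible : ∀ {a b} → a ≃ b → Negligible (λ n → a n xor b n)
≃⇒negligible {a} {b} a≃b k with a≃b k
... | N₀ , small = N₀ , λ N le → subst (λ c → c * 2 ^ k ≤ N) (mismatch≡count1-xor a b N) (small N le)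

negligible⇒≃ : ∀ {a b} → Negligible (λ n → a n xor b n) → a ≃ b
negligible⇒≃ {a} {b} neg k with neg k
... | N₀ , small = N₀ , λ N le → subst (λ c → c * 2 ^ k ≤ N) (sym (mismatch≡count1-xor a b N)) (small N le)

≃-reflexive : ∀ {a b} → (∀ n → a n ≡ b n) → a ≃ b
≃-reflexive {a} {b} a≗b = negligible⇒≃ (negligible-⇒ agree negligible-false)
  where
  agree : ∀ n → T (a n xor b n) → T false
  agree n rewrite a≗b n | xor-same (b n) = λ ()

≃-trans : ∀ {a b c} → a ≃ b → b ≃ c → a ≃ c
≃-trans {a} {b} {c} a≃b b≃c = negligible⇒≃
  (negligible-⇒ (λ n → xor-triangle (a n) (b n) (c n)) (negligible-∨ (≃⇒negligible a≃b) (≃⇒negligible b≃c)))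

≃-subsample : ∀ {a b} e → e < 2 → a ≃ b → (λ n → a (2 * n + e)) ≃ (λ n → b (2 * n + e))
≃-subsample e e<2 a≃b = negligible⇒≃ (negligible-subsample e e<2 (≃⇒negligible a≃b))

kernelSeq-suc : ∀ a i e r n → kernelSeq a (suc i) (e * 2 ^ i + r) n ≡ kernelSeq a i r (2 * n + e)
kernelSeq-suc a i e r n = cong a (2*p*n+[e*p+r]≡p*[2*n+e]+r (2 ^ i) n e r)
  where
  2*p*n+[e*p+r]≡p*[2*n+e]+r : ∀ p n e r → 2 * p * n + (e * p + r) ≡ p * (2 * n + e) + r
  2*p*n+[e*p+r]≡p*[2*n+e]+r = solve-∀

<2^[1+n]-split : ∀ n r → r < 2 ^ suc n → ∃₂ λ e r′ → e < 2 × r′ < 2 ^ n × r ≡ e * 2 ^ n + r′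
<2^[1+n]-split n r r<2^[1+n] with r <? 2 ^ n
... | yes r<2^n = 0 , r , z<s , r<2^n , refl
... | no  r≮2^n = 1 , r ∸ 2 ^ n , s<s z<s , r′<2^n , r≡
  where
  r≡ : r ≡ 1 * 2 ^ n + (r ∸ 2 ^ n)
  r≡ = sym (trans (cong (_+ (r ∸ 2 ^ n)) (*-identityˡ (2 ^ n))) (m+[n∸m]≡n (≮⇒≥ r≮2^n)))
  r′<2^n : r ∸ 2 ^ n < 2 ^ n
  r′<2^n = +-cancelˡ-< (2 ^ n) _ _ (subst₂ _<_ (sym (m+[n∸m]≡n (≮⇒≥ r≮2^n))) (2^[1+n]≡2^n+2^n n) r<2^[1+n])

kernel-≃ : ∀ a → (∀ e → e < 2 → (λ n → a (2 * n + e)) ≃ a) → ∀ i r → r < 2 ^ i → kernelSeq a i r ≃ a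
kernel-≃ a self zero    zero    _ = ≃-reflexive (λ n → cong a (trans (+-identityʳ _) (*-identityˡ n)))
kernel-≃ a self zero    (suc r) (s<s ())
kernel-≃ a self (suc i) r r<2^[1+i] with <2^[1+n]-split i r r<2^[1+i]
... | e , r′ , e<2 , r′<2^i , refl =
  ≃-trans (≃-reflexive (kernelSeq-suc a i e r′))
    (≃-trans (≃-subsample e e<2 (kernel-≃ a self i r′ r′<2^i)) (self e e<2))

self-similar⇒asympAutomatic2 : ∀ a → (∀ e → e < 2 → (λ n → a (2 * n + e)) ≃ a) → AsympAutomatic2 a
self-similar⇒asympAutomatic2 a self = a ∷ [] , λ i r r<2^i → here (kernel-≃ a self i r r<2^i)

DensityBounds : ℕ → ℕ → ℕ → (ℕ → Bool) → Set
DensityBounds s q e f = ∀ x → s * x ≤ count1 f x * q × count1 f x * q ≤ suc s * x + e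

splice : {A : Set} → ℕ → (ℕ → A) → (ℕ → A) → ℕ → A
splice P f g x = if x <ᵇ P then f x else g x

splice-< : ∀ {A : Set} P (f g : ℕ → A) {x} → x < P → splice P f g x ≡ f x
splice-< P f g {x} x<P = cong (if_then f x else g x) (<ᵇ≡true x<P)

splice-≥ : ∀ {A : Set} P (f g : ℕ → A) {x} → P ≤ x → splice P f g x ≡ g x
splice-≥ P f g {x} P≤x = cong (if_then f x else g x) (<ᵇ≡false (≤⇒≯ P≤x))

count1-splice-≤ : ∀ P f g {x} → x ≤ P → count1 (splice P f g) x ≡ count1 f x
count1-splice-≤ P f g {x} x≤P = count1-cong x (λ i i<x → splice-< P f g (<-≤-trans i<x x≤P))

count1-splice-+ : ∀ P f g → (∀ i → g (P + i) ≡ g i) → ∀ y → count1 (splice P f g) (P + y) ≡ count1 f P + count1 g y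
count1-splice-+ P f g per y = trans (count1-+ (splice P f g) P y)
  (cong₂ _+_ (count1-splice-≤ P f g ≤-refl) (count1-cong y (λ i _ → trans (splice-≥ P f g (m≤m+n P i)) (per i))))

splice-density : ∀ {s q e₁ e₂} P f g → (∀ i → g (P + i) ≡ g i) →
  DensityBounds s q e₁ f → DensityBounds s q e₂ g → DensityBounds s q (e₁ + e₂) (splice P f g)
splice-density {s} {q} {e₁} {e₂} P f g per dens-f dens-g x with x ≤? P
... | yes x≤P rewrite count1-splice-≤ P f g x≤P =
  proj₁ (dens-f x) , ≤-trans (proj₂ (dens-f x)) (≤-trans (m≤m+n _ e₂) (≤-reflexive (+-assoc (suc s * x) e₁ e₂)))
... | no  x≰P = subst (λ x → s * x ≤ count1 h x * q × count1 h x * q ≤ suc s * x + (e₁ + e₂))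
                      (m+[n∸m]≡n (<⇒≤ (≰⇒> x≰P))) (beyond (x ∸ P))
  where
  h : ℕ → Bool
  h = splice P f g
  open ≤-Reasoning
  beyond : ∀ y → s * (P + y) ≤ count1 h (P + y) * q × count1 h (P + y) * q ≤ suc s * (P + y) + (e₁ + e₂)
  beyond y rewrite count1-splice-+ P f g per y = lower , upper
    where
    lower : s * (P + y) ≤ (count1 f P + count1 g y) * q
    lower = begin
      s * (P + y)                        ≡⟨ *-distribˡ-+ s P y ⟩
      s * P + s * y                      ≤⟨ +-mono-≤ (proj₁ (dens-f P)) (proj₁ (dens-g y)) ⟩
      count1 f P * q + count1 g y * q    ≡⟨ sym (*-distribʳ-+ q (count1 f P) _) ⟩
      (count1 f P + count1 g y) * q      ∎
    upper : (count1 f P + count1 g y) * q ≤ suc s * (P + y) + (e₁ + e₂)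
    upper = begin
      (count1 f P + count1 g y) * q                  ≡⟨ *-distribʳ-+ q (count1 f P) _ ⟩
      count1 f P * q + count1 g y * q                ≤⟨ +-mono-≤ (proj₂ (dens-f P)) (proj₂ (dens-g y)) ⟩
      (suc s * P + e₁) + (suc s * y + e₂)            ≡⟨ regroup (suc s) P y e₁ e₂ ⟩
      suc s * (P + y) + (e₁ + e₂)                    ∎
      where
      regroup : ∀ r P y e₁ e₂ → (r * P + e₁) + (r * y + e₂) ≡ r * (P + y) + (e₁ + e₂)
      regroup = solve-∀

count1-dyadicConcat : ∀ b L j → j ≤ 2 ^ L →
  count1 (dyadicConcat b) (2 ^ L + j) ≡ count1 (dyadicConcat b) (2 ^ L) + count1 (b L) j
count1-dyadicConcat b L j j≤2^L = trans (count1-+ (dyadicConcat b) (2 ^ L) j)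
  (cong (_ +_) (count1-cong j (λ i i<j → dyadicConcat-block b L i (<-≤-trans i<j j≤2^L))))

-- Each block errs by at most 2^L/4, so the errors of all blocks below N sum to at most N/2.
module DyadicFrequency (b : ℕ → Seq) (s q : ℕ) .{{_ : NonZero q}} (L₀ : ℕ) (e : ℕ → ℕ) (s≤q : s ≤ q)
  (blocks : ∀ L → L₀ ≤ L → DensityBounds s q (e L) (b L) × e L * 4 ≤ 2 ^ L) where

  a : Seq
  a = dyadicConcat b
  C : ℕ
  C = 2 ^ L₀ * q
  A : ℕ → ℕ
  A L = count1 a (2 ^ L)
  B : ℕ → ℕ → ℕ
  B L j = count1 (b L) j
  open ≤-Reasoning
  A-suc : ∀ L → A (suc L) ≡ A L + B L (2 ^ L)
  A-suc L = trans (cong (count1 a) (2^[1+n]≡2^n+2^n L)) (count1-dyadicConcat b L (2 ^ L) ≤-refl)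

  lower-prefix : ∀ L → L₀ ≤ L → s * 2 ^ L ≤ A L * q + C
  lower-prefix = induction-from (λ L → s * 2 ^ L ≤ A L * q + C)
    (≤-trans (*-monoˡ-≤ (2 ^ L₀) s≤q) (≤-trans (≤-reflexive (*-comm q (2 ^ L₀))) (m≤n+m C _)))
    λ L L₀≤L ih → begin
      s * 2 ^ suc L                        ≡⟨ cong (s *_) (2^[1+n]≡2^n+2^n L) ⟩
      s * (2 ^ L + 2 ^ L)                  ≡⟨ *-distribˡ-+ s (2 ^ L) (2 ^ L) ⟩
      s * 2 ^ L + s * 2 ^ L                ≤⟨ +-mono-≤ ih (proj₁ (proj₁ (blocks L L₀≤L) (2 ^ L))) ⟩
      A L * q + C + B L (2 ^ L) * q        ≡⟨ regroup (A L) (B L (2 ^ L)) q C ⟩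
      (A L + B L (2 ^ L)) * q + C          ≡⟨ cong (λ x → x * q + C) (sym (A-suc L)) ⟩
      A (suc L) * q + C                    ∎
    where
    regroup : ∀ x y q c → x * q + c + y * q ≡ (x + y) * q + c
    regroup = solve-∀

  upper-prefix : ∀ L → L₀ ≤ L → A L * q * 4 ≤ suc s * 2 ^ L * 4 + 2 ^ L + C * 4
  upper-prefix = induction-from (λ L → A L * q * 4 ≤ suc s * 2 ^ L * 4 + 2 ^ L + C * 4)
    (≤-trans (*-monoˡ-≤ 4 (*-monoˡ-≤ q (count1-≤ a (2 ^ L₀)))) (m≤n+m (C * 4) _))
    λ L L₀≤L ih → let dens , small = blocks L L₀≤L ; X = 2 ^ L in begin
      A (suc L) * q * 4                                  ≡⟨ cong (λ x → x * q * 4) (A-suc L) ⟩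
      (A L + B L X) * q * 4                              ≡⟨ distrib (A L) (B L X) q ⟩
      A L * q * 4 + B L X * q * 4                        ≤⟨ +-mono-≤ ih (*-monoˡ-≤ 4 (proj₂ (dens X))) ⟩
      (suc s * X * 4 + X + C * 4) + (suc s * X + e L) * 4 ≡⟨ cong (suc s * X * 4 + X + C * 4 +_) (*-distribʳ-+ 4 (suc s * X) (e L)) ⟩
      (suc s * X * 4 + X + C * 4) + (suc s * X * 4 + e L * 4) ≤⟨ +-monoʳ-≤ (suc s * X * 4 + X + C * 4) (+-monoʳ-≤ (suc s * X * 4) small) ⟩
      (suc s * X * 4 + X + C * 4) + (suc s * X * 4 + X)  ≡⟨ regroup (suc s) X C ⟩
      suc s * (X + X) * 4 + (X + X) + C * 4              ≡⟨ cong (λ y → suc s * y * 4 + y + C * 4) (sym (2^[1+n]≡2^n+2^n L)) ⟩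
      suc s * 2 ^ suc L * 4 + 2 ^ suc L + C * 4          ∎
    where
    distrib : ∀ x y q → (x + y) * q * 4 ≡ x * q * 4 + y * q * 4
    distrib = solve-∀
    regroup : ∀ r X C → (r * X * 4 + X + C * 4) + (r * X * 4 + X) ≡ r * (X + X) * 4 + (X + X) + C * 4
    regroup = solve-∀

  final : ∀ N → 2 * C ≤ N → (s * N ≤ count1 a N * q + N) × (count1 a N * q ≤ (s + 2) * N)
  final N 2C≤N with dyadic-split L₀ N (≤-trans (m≤m*n (2 ^ L₀) q) (≤-trans (m≤n*m C 2) 2C≤N))
  ... | L , j , L₀≤L , refl , j<2^L
    rewrite count1-dyadicConcat b L j (<⇒≤ j<2^L) = lower , *-cancelˡ-≤ 4 upper
    where
    X : ℕ
    X = 2 ^ L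
    dens : DensityBounds s q (e L) (b L)
    dens = proj₁ (blocks L L₀≤L)
    small : e L * 4 ≤ 2 ^ L
    small = proj₂ (blocks L L₀≤L)
    C≤N : C ≤ N
    C≤N = ≤-trans (m≤n*m C 2) 2C≤N
    lower : s * N ≤ (A L + B L j) * q + N
    lower = begin
      s * (X + j)                        ≡⟨ *-distribˡ-+ s X j ⟩
      s * X + s * j                      ≤⟨ +-mono-≤ (lower-prefix L L₀≤L) (proj₁ (dens j)) ⟩
      A L * q + C + B L j * q            ≡⟨ regroup (A L) (B L j) q C ⟩
      (A L + B L j) * q + C              ≤⟨ +-monoʳ-≤ _ C≤N ⟩
      (A L + B L j) * q + N              ∎
      where
      regroup : ∀ x y q c → x * q + c + y * q ≡ (x + y) * q + c
      regroup = solve-∀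
    upper : 4 * ((A L + B L j) * q) ≤ 4 * ((s + 2) * N)
    upper = begin
      4 * ((A L + B L j) * q)                                 ≡⟨ distrib (A L) (B L j) q ⟩
      A L * q * 4 + B L j * q * 4                             ≤⟨ +-mono-≤ (upper-prefix L L₀≤L) (*-monoˡ-≤ 4 (proj₂ (dens j))) ⟩
      (suc s * X * 4 + X + C * 4) + (suc s * j + e L) * 4     ≡⟨ cong (suc s * X * 4 + X + C * 4 +_) (*-distribʳ-+ 4 (suc s * j) (e L)) ⟩
      (suc s * X * 4 + X + C * 4) + (suc s * j * 4 + e L * 4) ≤⟨ +-monoʳ-≤ (suc s * X * 4 + X + C * 4) (+-monoʳ-≤ (suc s * j * 4) small) ⟩
      (suc s * X * 4 + X + C * 4) + (suc s * j * 4 + X)       ≡⟨ regroup (suc s) X j C ⟩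
      suc s * N * 4 + (X + X) + C * 2 * 2                     ≤⟨ +-mono-≤ (+-monoʳ-≤ (suc s * N * 4) (+-mono-≤ X≤N X≤N))
                                                                           (*-monoˡ-≤ 2 (≤-trans (≤-reflexive (*-comm C 2)) 2C≤N)) ⟩
      suc s * N * 4 + (N + N) + N * 2                         ≡⟨ collect s N ⟩
      4 * ((s + 2) * N)                                       ∎
      where
      X≤N : X ≤ N
      X≤N = m≤m+n X j
      distrib : ∀ x y q → 4 * ((x + y) * q) ≡ x * q * 4 + y * q * 4
      distrib = solve-∀
      regroup : ∀ r X j c → (r * X * 4 + X + c * 4) + (r * j * 4 + X) ≡ r * (X + j) * 4 + (X + X) + c * 2 * 2
      regroup = solve-∀
      collect : ∀ s N → suc s * N * 4 + (N + N) + N * 2 ≡ 4 * ((s + 2) * N)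
      collect = solve-∀

  frequency : ∃ λ N₀ → ∀ N → N₀ ≤ N → (s * N ≤ count1 a N * q + N) × (count1 a N * q ≤ (s + 2) * N)
  frequency = 2 * C , final

2*m+e<2*n : ∀ {m n e} → e < 2 → m < n → 2 * m + e < 2 * n
2*m+e<2*n {m} {n} {e} e<2 m<n = begin-strict
  2 * m + e     <⟨ +-monoʳ-< (2 * m) e<2 ⟩
  2 * m + 2     ≡⟨ 2*m+2≡2*[1+m] m ⟩
  2 * suc m     ≤⟨ *-monoʳ-≤ 2 m<n ⟩
  2 * n         ∎
  where
  open ≤-Reasoning
  2*m+2≡2*[1+m] : ∀ m → 2 * m + 2 ≡ 2 * suc m
  2*m+2≡2*[1+m] = solve-∀

-- Instance search cannot find NonZero (2 ^ n) for a variable n, so it is supplied here once.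
_%2^_ : ℕ → ℕ → ℕ
m %2^ n = (m % 2 ^ n) {{m^n≢0 2 n}}

_/2^_ : ℕ → ℕ → ℕ
m /2^ n = (m / 2 ^ n) {{m^n≢0 2 n}}

m≡m%2^n+[m/2^n]*2^n : ∀ m n → m ≡ m %2^ n + m /2^ n * 2 ^ n
m≡m%2^n+[m/2^n]*2^n m n = m≡m%n+[m/n]*n m (2 ^ n) {{m^n≢0 2 n}}

m%2^n<2^n : ∀ m n → m %2^ n < 2 ^ n
m%2^n<2^n m n = m%n<n m (2 ^ n) {{m^n≢0 2 n}}

m<2^n⇒m%2^n≡m : ∀ {m} n → m < 2 ^ n → m %2^ n ≡ m
m<2^n⇒m%2^n≡m n = m<n⇒m%n≡m {{m^n≢0 2 n}}

[m+k*2^n]%2^n≡m%2^n : ∀ m k n → (m + k * 2 ^ n) %2^ n ≡ m %2^ n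
[m+k*2^n]%2^n≡m%2^n m k n = [m+kn]%n≡m%n m k (2 ^ n) {{m^n≢0 2 n}}

[2^n+m]%2^n≡m%2^n : ∀ m n → (2 ^ n + m) %2^ n ≡ m %2^ n
[2^n+m]%2^n≡m%2^n m n = trans (cong (_%2^ n) (2^n+m≡m+1*2^n (2 ^ n) m)) ([m+k*2^n]%2^n≡m%2^n m 1 n)
  where
  2^n+m≡m+1*2^n : ∀ p m → p + m ≡ m + 1 * p
  2^n+m≡m+1*2^n = solve-∀

[2*m+e]%2^[1+n] : ∀ m n e → e < 2 → (2 * m + e) %2^ suc n ≡ 2 * (m %2^ n) + e
[2*m+e]%2^[1+n] m n e e<2 = begin
  (2 * m + e) %2^ suc n                                ≡⟨ cong (λ x → (2 * x + e) %2^ suc n) (m≡m%2^n+[m/2^n]*2^n m n) ⟩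
  (2 * (m %2^ n + m /2^ n * 2 ^ n) + e) %2^ suc n      ≡⟨ cong (_%2^ suc n) (regroup (m %2^ n) (m /2^ n) (2 ^ n) e) ⟩
  (2 * (m %2^ n) + e + m /2^ n * 2 ^ suc n) %2^ suc n  ≡⟨ [m+k*2^n]%2^n≡m%2^n (2 * (m %2^ n) + e) (m /2^ n) (suc n) ⟩
  (2 * (m %2^ n) + e) %2^ suc n                        ≡⟨ m<2^n⇒m%2^n≡m (suc n) (2*m+e<2*n e<2 (m%2^n<2^n m n)) ⟩
  2 * (m %2^ n) + e                                    ∎
  where
  open ≡-Reasoning
  regroup : ∀ r q p e → 2 * (r + q * p) + e ≡ 2 * r + e + q * (2 * p)
  regroup = solve-∀

<ᵇ-double : ∀ m n e b → m ≢ n → e < 2 → b < 2 → (2 * m + e <ᵇ 2 * n + b) ≡ (m <ᵇ n)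
<ᵇ-double m n e b m≢n e<2 b<2 with <-cmp m n
... | tri< m<n _ _ = trans (<ᵇ≡true (<-≤-trans (2*m+e<2*n e<2 m<n) (m≤m+n (2 * n) b))) (sym (<ᵇ≡true m<n))
... | tri≈ _ m≡n _ = ⊥-elim (m≢n m≡n)
... | tri> _ _ n<m = trans (<ᵇ≡false (≤⇒≯ (≤-trans (<⇒≤ (2*m+e<2*n b<2 n<m)) (m≤m+n (2 * m) e)))) (sym (<ᵇ≡false (<⇒≯ n<m)))

count1-residue : ∀ m c r → count1 (λ j → j %2^ m ≡ᵇ r) (c * 2 ^ m) ≤ c
count1-residue m c r = begin
  count1 f (c * 2 ^ m)                      ≡⟨ cong (count1 f) (sym (+-identityʳ (c * 2 ^ m))) ⟩
  count1 f (c * 2 ^ m + 0)                  ≡⟨ count1-periodic f (2 ^ m) (λ i → cong (_≡ᵇ r) ([2^n+m]%2^n≡m%2^n i m)) c 0 ⟩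
  c * count1 f (2 ^ m) + 0                  ≡⟨ +-identityʳ _ ⟩
  c * count1 f (2 ^ m)                      ≡⟨ cong (c *_) (count1-cong (2 ^ m) (λ j j<2^m → cong (_≡ᵇ r) (m<2^n⇒m%2^n≡m m j<2^m))) ⟩
  c * count1 (_≡ᵇ r) (2 ^ m)                ≤⟨ *-monoʳ-≤ c (count1-window (_≡ᵇ r) r 1 (2 ^ m) only-r) ⟩
  c * 1                                     ≡⟨ *-identityʳ c ⟩
  c                                         ∎
  where
  open ≤-Reasoning
  f : ℕ → Bool
  f = λ j → j %2^ m ≡ᵇ r
  only-r : ∀ j → T (j ≡ᵇ r) → r ≤ j × j < r + 1
  only-r j j≡r with ≡ᵇ⇒≡ j r j≡r
  ... | refl = ≤-refl , subst (j <_) (+-comm 1 j) ≤-refl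

-- For L + 1 = 2^K + t with t < 2^K: slack L = K, progress L = t, patternExp L = M = L − K − 1 and
-- switchPoint L = t·2^(M+1).
slack : ℕ → ℕ
slack L = ⌊log₂ suc L ⌋

progress : ℕ → ℕ
progress L = suc L ∸ 2 ^ slack L

patternExp : ℕ → ℕ
patternExp L = L ∸ suc (slack L)

switchPoint : ℕ → ℕ
switchPoint L = progress L * 2 ^ suc (patternExp L)

exponentAt : ℕ → ℕ → ℕ
exponentAt L = splice (switchPoint L) (λ _ → patternExp L) (λ _ → suc (patternExp L))

2*n+2≤2^n : ∀ n → 3 ≤ n → 2 * n + 2 ≤ 2 ^ n
2*n+2≤2^n = induction-from (λ n → 2 * n + 2 ≤ 2 ^ n) ≤-refl λ n 3≤n ih → begin
  2 * suc n + 2      ≡⟨ regroup n ⟩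
  (2 * n + 2) + 2    ≤⟨ +-mono-≤ ih (^-monoʳ-≤ 2 {1} (≤-trans (s≤s z≤n) 3≤n)) ⟩
  2 ^ n + 2 ^ n      ≡⟨ sym (2^[1+n]≡2^n+2^n n) ⟩
  2 ^ suc n          ∎
  where
  open ≤-Reasoning
  regroup : ∀ n → 2 * suc n + 2 ≡ (2 * n + 2) + 2
  regroup = solve-∀

2^[1+m+n]≡2^m*2^[1+n] : ∀ m n → 2 ^ (suc m + n) ≡ 2 ^ m * 2 ^ suc n
2^[1+m+n]≡2^m*2^[1+n] m n = trans (cong (2 ^_) (sym (+-suc m n))) (^-distribˡ-+-* 2 m (suc n))

level-split : ∀ L → suc L ≡ 2 ^ slack L + progress L × progress L < 2 ^ slack L
level-split L = suc-L≡ , +-cancelˡ-< (2 ^ slack L) _ _ (subst₂ _<_ suc-L≡ (2^[1+n]≡2^n+2^n (slack L)) (proj₂ bounds))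
  where
  bounds : 2 ^ slack L ≤ suc L × suc L < 2 ^ suc (slack L)
  bounds = ⌊log₂⌋-bounds (suc L) z<s
  suc-L≡ : suc L ≡ 2 ^ slack L + progress L
  suc-L≡ = sym (m+[n∸m]≡n (proj₁ bounds))

level-large : ∀ L → 3 ≤ slack L → L ≡ suc (slack L) + patternExp L × slack L ≤ patternExp L
level-large L 3≤K = sym (m+[n∸m]≡n (m+n≤o⇒m≤o (suc K) room)) , m+n≤o⇒m≤o∸n K (subst (_≤ L) (+-comm (suc K) K) room)
  where
  K : ℕ
  K = slack L
  room : suc K + K ≤ L
  room = s≤s⁻¹ (begin
    suc (suc K + K)    ≡⟨ regroup K ⟩
    2 * K + 2          ≤⟨ 2*n+2≤2^n K 3≤K ⟩
    2 ^ K              ≤⟨ ⌊log₂⌋-bounds (suc L) z<s .proj₁ ⟩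
    suc L              ∎)
    where
    open ≤-Reasoning
    regroup : ∀ K → suc (suc K + K) ≡ 2 * K + 2
    regroup = solve-∀

2^L≡2^slack*2^[1+patternExp] : ∀ L → 3 ≤ slack L → 2 ^ L ≡ 2 ^ slack L * 2 ^ suc (patternExp L)
2^L≡2^slack*2^[1+patternExp] L 3≤K =
  trans (cong (2 ^_) (proj₁ (level-large L 3≤K))) (2^[1+m+n]≡2^m*2^[1+n] (slack L) (patternExp L))

level-suc-within : ∀ L → 3 ≤ slack L → suc (progress L) < 2 ^ slack L →
  slack (suc L) ≡ slack L × progress (suc L) ≡ suc (progress L) × patternExp (suc L) ≡ suc (patternExp L)
level-suc-within L 3≤K within = K′≡K , t′≡1+t , M′≡1+M
  where
  K t : ℕ
  K = slack L
  t = progress L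
  2+L≡2^K+[1+t] : suc (suc L) ≡ 2 ^ K + suc t
  2+L≡2^K+[1+t] = trans (cong suc (proj₁ (level-split L))) (sym (+-suc (2 ^ K) t))
  K′≡K : slack (suc L) ≡ K
  K′≡K = ⌊log₂⌋-unique K (suc (suc L)) (subst (2 ^ K ≤_) (sym 2+L≡2^K+[1+t]) (m≤m+n _ _))
                                       (subst (_< 2 ^ suc K) (sym 2+L≡2^K+[1+t]) (2^n+m<2^[1+n] K within))
  t′≡1+t : progress (suc L) ≡ suc t
  t′≡1+t = trans (cong (λ k → suc (suc L) ∸ 2 ^ k) K′≡K)
                 (trans (cong (_∸ 2 ^ K) 2+L≡2^K+[1+t]) (m+n∸m≡n (2 ^ K) (suc t)))
  M′≡1+M : patternExp (suc L) ≡ suc (patternExp L)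
  M′≡1+M = trans (cong (λ k → suc L ∸ suc k) K′≡K)
                 (+-∸-assoc 1 (subst (suc K ≤_) (sym (proj₁ (level-large L 3≤K))) (m≤m+n (suc K) _)))

level-suc-wrap : ∀ L → suc (progress L) ≡ 2 ^ slack L →
  slack (suc L) ≡ suc (slack L) × progress (suc L) ≡ 0 × patternExp (suc L) ≡ patternExp L
level-suc-wrap L full = K′≡1+K , t′≡0 , cong (λ k → suc L ∸ suc k) K′≡1+K
  where
  K : ℕ
  K = slack L
  2+L≡2^[1+K] : suc (suc L) ≡ 2 ^ suc K
  2+L≡2^[1+K] = begin
    suc (suc L)              ≡⟨ cong suc (proj₁ (level-split L)) ⟩
    suc (2 ^ K + progress L) ≡⟨ sym (+-suc (2 ^ K) (progress L)) ⟩
    2 ^ K + suc (progress L) ≡⟨ cong (2 ^ K +_) full ⟩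
    2 ^ K + 2 ^ K            ≡⟨ sym (2^[1+n]≡2^n+2^n K) ⟩
    2 ^ suc K                ∎
    where open ≡-Reasoning
  K′≡1+K : slack (suc L) ≡ suc K
  K′≡1+K = ⌊log₂⌋-unique (suc K) (suc (suc L)) (≤-reflexive (sym 2+L≡2^[1+K]))
             (subst (_< 2 ^ suc (suc K)) (sym 2+L≡2^[1+K]) (^-monoʳ-< 2 (s≤s (s≤s z≤n)) (n<1+n (suc K))))
  t′≡0 : progress (suc L) ≡ 0
  t′≡0 = trans (cong (λ k → suc (suc L) ∸ 2 ^ k) K′≡1+K) (trans (cong (_∸ 2 ^ suc K) 2+L≡2^[1+K]) (n∸n≡0 (2 ^ suc K)))

exponentAt-cong : ∀ L {t M} → progress L ≡ t → patternExp L ≡ M →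
  ∀ x → exponentAt L x ≡ splice (t * 2 ^ suc M) (λ _ → M) (λ _ → suc M) x
exponentAt-cong L refl refl x = refl

-- Passing to level L + 1 moves the switch point P = t·2^(M+1) to (t+1)·2^(M+2) = 2(P + W) with
-- W = 2^(M+1), so doubling keeps j on its side of the switch unless j ∈ [P, P + W); when L + 2 is a
-- power of 2 the next level restarts at t = 0 with the same M, and [P, P + W) is the block's tail.
exponentAt-suc-within : ∀ L {j e} → 3 ≤ slack L → suc (progress L) < 2 ^ slack L → e < 2 →
  j < switchPoint L ⊎ switchPoint L + 2 ^ suc (patternExp L) ≤ j →
  exponentAt (suc L) (2 * j + e) ≡ suc (exponentAt L j)
exponentAt-suc-within L {j} {e} 3≤K within e<2 outside =
  trans (exponentAt-cong (suc L) t′≡1+t M′≡1+M (2 * j + e)) (step outside)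
  where
  t M P W P′ : ℕ
  t = progress L
  M = patternExp L
  P = switchPoint L
  W = 2 ^ suc M
  P′ = suc t * 2 ^ suc (suc M)
  t′≡1+t : progress (suc L) ≡ suc t
  t′≡1+t = proj₁ (proj₂ (level-suc-within L 3≤K within))
  M′≡1+M : patternExp (suc L) ≡ suc M
  M′≡1+M = proj₂ (proj₂ (level-suc-within L 3≤K within))
  P′≡2*[P+W] : P′ ≡ 2 * (P + W)
  P′≡2*[P+W] = regroup t W
    where
    regroup : ∀ t W → suc t * (2 * W) ≡ 2 * (t * W + W)
    regroup = solve-∀
  step : j < P ⊎ P + W ≤ j → splice P′ (λ _ → suc M) (λ _ → suc (suc M)) (2 * j + e) ≡ suc (exponentAt L j)
  step (inj₁ j<P) = trans
    (splice-< P′ (λ _ → suc M) (λ _ → suc (suc M))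
      (<-≤-trans (2*m+e<2*n e<2 j<P) (≤-trans (*-monoʳ-≤ 2 (m≤m+n P W)) (≤-reflexive (sym P′≡2*[P+W])))))
    (cong suc (sym (splice-< P (λ _ → M) (λ _ → suc M) j<P)))
  step (inj₂ P+W≤j) = trans
    (splice-≥ P′ (λ _ → suc M) (λ _ → suc (suc M))
      (≤-trans (≤-reflexive P′≡2*[P+W]) (≤-trans (*-monoʳ-≤ 2 P+W≤j) (m≤m+n (2 * j) e))))
    (cong suc (sym (splice-≥ P (λ _ → M) (λ _ → suc M) (≤-trans (m≤m+n P W) P+W≤j))))

exponentAt-suc-wrap : ∀ L {j e} → 3 ≤ slack L → suc (progress L) ≡ 2 ^ slack L → j < 2 ^ L →
  j < switchPoint L ⊎ switchPoint L + 2 ^ suc (patternExp L) ≤ j →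
  exponentAt (suc L) (2 * j + e) ≡ suc (exponentAt L j)
exponentAt-suc-wrap L {j} {e} 3≤K full j<2^L outside = begin
  exponentAt (suc L) (2 * j + e)                              ≡⟨ exponentAt-cong (suc L) t′≡0 M′≡M (2 * j + e) ⟩
  splice (0 * 2 ^ suc M) (λ _ → M) (λ _ → suc M) (2 * j + e)  ≡⟨ splice-≥ (0 * W) (λ _ → M) (λ _ → suc M) {2 * j + e} z≤n ⟩
  suc M                                                       ≡⟨ step outside ⟩
  suc (exponentAt L j)                                        ∎
  where
  open ≡-Reasoning
  M P W : ℕ
  M = patternExp L
  P = switchPoint L
  W = 2 ^ suc M
  t′≡0 : progress (suc L) ≡ 0
  t′≡0 = proj₁ (proj₂ (level-suc-wrap L full))
  M′≡M : patternExp (suc L) ≡ M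
  M′≡M = proj₂ (proj₂ (level-suc-wrap L full))
  P+W≡2^L : P + W ≡ 2 ^ L
  P+W≡2^L = trans (+-comm P W) (trans (cong (_* W) full) (sym (2^L≡2^slack*2^[1+patternExp] L 3≤K)))
  step : j < P ⊎ P + W ≤ j → suc M ≡ suc (exponentAt L j)
  step (inj₁ j<P)   = cong suc (sym (splice-< P (λ _ → M) (λ _ → suc M) j<P))
  step (inj₂ P+W≤j) = ⊥-elim (<⇒≱ j<2^L (subst (_≤ j) P+W≡2^L P+W≤j))

exponentAt-suc : ∀ L {j e} → 3 ≤ slack L → e < 2 → j < 2 ^ L →
  j < switchPoint L ⊎ switchPoint L + 2 ^ suc (patternExp L) ≤ j →
  exponentAt (suc L) (2 * j + e) ≡ suc (exponentAt L j)
exponentAt-suc L 3≤K e<2 j<2^L outside with suc (progress L) <? 2 ^ slack L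
... | yes within = exponentAt-suc-within L 3≤K within e<2 outside
... | no  ¬within = exponentAt-suc-wrap L 3≤K (≤-antisym (proj₂ (level-split L)) (≮⇒≥ ¬within)) j<2^L outside

switchWindow : ℕ → ℕ → Bool
switchWindow L j = (switchPoint L ≤ᵇ j) ∧ (j <ᵇ switchPoint L + 2 ^ suc (patternExp L))

module _ (d : ℕ → Bool) where

  trunc-lower : ∀ k i → trunc d k * 2 ^ i ≤ trunc d (k + i)
  trunc-lower k zero    rewrite +-identityʳ k | *-identityʳ (trunc d k) = ≤-refl
  trunc-lower k (suc i) rewrite +-suc k i = begin
    trunc d k * (2 * 2 ^ i)                 ≡⟨ x*[2*y]≡2*[x*y] (trunc d k) (2 ^ i) ⟩
    2 * (trunc d k * 2 ^ i)                 ≤⟨ *-monoʳ-≤ 2 (trunc-lower k i) ⟩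
    2 * trunc d (k + i)                     ≤⟨ m≤m+n _ _ ⟩
    2 * trunc d (k + i) + bit (d (k + i))   ∎
    where
    open ≤-Reasoning
    x*[2*y]≡2*[x*y] : ∀ x y → x * (2 * y) ≡ 2 * (x * y)
    x*[2*y]≡2*[x*y] = solve-∀

  trunc-upper : ∀ k i → suc (trunc d (k + i)) ≤ suc (trunc d k) * 2 ^ i
  trunc-upper k zero    rewrite +-identityʳ k | *-identityʳ (suc (trunc d k)) = ≤-refl
  trunc-upper k (suc i) rewrite +-suc k i = begin
    suc (2 * trunc d (k + i) + bit (d (k + i)))   ≤⟨ s≤s (+-monoʳ-≤ (2 * trunc d (k + i)) (bit≤1 (d (k + i)))) ⟩
    suc (2 * trunc d (k + i) + 1)                 ≡⟨ 1+[2*x+1]≡2*[1+x] (trunc d (k + i)) ⟩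
    2 * suc (trunc d (k + i))                     ≤⟨ *-monoʳ-≤ 2 (trunc-upper k i) ⟩
    2 * (suc (trunc d k) * 2 ^ i)                 ≡⟨ 2*[x*y]≡x*[2*y] (suc (trunc d k)) (2 ^ i) ⟩
    suc (trunc d k) * (2 * 2 ^ i)                 ∎
    where
    open ≤-Reasoning
    1+[2*x+1]≡2*[1+x] : ∀ x → suc (2 * x + 1) ≡ 2 * suc x
    1+[2*x+1]≡2*[1+x] = solve-∀
    2*[x*y]≡x*[2*y] : ∀ x y → 2 * (x * y) ≡ x * (2 * y)
    2*[x*y]≡x*[2*y] = solve-∀

  trunc<2^ : ∀ m → trunc d m < 2 ^ m
  trunc<2^ m = subst (suc (trunc d m) ≤_) (+-identityʳ (2 ^ m)) (trunc-upper 0 m)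

  trunc-ratio-lower : ∀ {k m} → k ≤ m → trunc d k * 2 ^ m ≤ trunc d m * 2 ^ k
  trunc-ratio-lower {k} {m} k≤m with m ∸ k | m+[n∸m]≡n k≤m
  ... | i | refl = begin
    trunc d k * 2 ^ (k + i)          ≡⟨ cong (trunc d k *_) (^-distribˡ-+-* 2 k i) ⟩
    trunc d k * (2 ^ k * 2 ^ i)      ≡⟨ x*[y*z]≡[x*z]*y (trunc d k) (2 ^ k) (2 ^ i) ⟩
    trunc d k * 2 ^ i * 2 ^ k        ≤⟨ *-monoˡ-≤ (2 ^ k) (trunc-lower k i) ⟩
    trunc d (k + i) * 2 ^ k          ∎
    where
    open ≤-Reasoning
    x*[y*z]≡[x*z]*y : ∀ x y z → x * (y * z) ≡ x * z * y
    x*[y*z]≡[x*z]*y = solve-∀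

  trunc-ratio-upper : ∀ {k m} → k ≤ m → trunc d m * 2 ^ k ≤ suc (trunc d k) * 2 ^ m
  trunc-ratio-upper {k} {m} k≤m with m ∸ k | m+[n∸m]≡n k≤m
  ... | i | refl = begin
    trunc d (k + i) * 2 ^ k              ≤⟨ *-monoˡ-≤ (2 ^ k) (≤-trans (n≤1+n _) (trunc-upper k i)) ⟩
    suc (trunc d k) * 2 ^ i * 2 ^ k      ≡⟨ [x*z]*y≡x*[y*z] (suc (trunc d k)) (2 ^ k) (2 ^ i) ⟩
    suc (trunc d k) * (2 ^ k * 2 ^ i)    ≡⟨ cong (suc (trunc d k) *_) (sym (^-distribˡ-+-* 2 k i)) ⟩
    suc (trunc d k) * 2 ^ (k + i)        ∎
    where
    open ≤-Reasoning
    [x*z]*y≡x*[y*z] : ∀ x y z → x * z * y ≡ x * (y * z)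
    [x*z]*y≡x*[y*z] = solve-∀

  truncPattern : ℕ → ℕ → Bool
  truncPattern m j = j %2^ m <ᵇ trunc d m

  truncPattern-periodic : ∀ m c i → truncPattern m (c * 2 ^ m + i) ≡ truncPattern m i
  truncPattern-periodic m c i =
    cong (_<ᵇ trunc d m) (trans (cong (_%2^ m) (+-comm (c * 2 ^ m) i)) ([m+k*2^n]%2^n≡m%2^n i c m))

  count1-truncPattern : ∀ m c r → r ≤ 2 ^ m → count1 (truncPattern m) (c * 2 ^ m + r) ≡ c * trunc d m + r ⊓ trunc d m
  count1-truncPattern m c r r≤2^m = begin
    count1 (truncPattern m) (c * 2 ^ m + r)                             ≡⟨ count1-periodic _ (2 ^ m) per c r ⟩
    c * count1 (truncPattern m) (2 ^ m) + count1 (truncPattern m) r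
      ≡⟨ cong₂ (λ x y → c * x + y) (first-period ≤-refl) (first-period r≤2^m) ⟩
    c * (2 ^ m ⊓ trunc d m) + r ⊓ trunc d m
      ≡⟨ cong (λ x → c * x + r ⊓ trunc d m) (m≥n⇒m⊓n≡n (<⇒≤ (trunc<2^ m))) ⟩
    c * trunc d m + r ⊓ trunc d m                                       ∎
    where
    open ≡-Reasoning
    per : ∀ i → truncPattern m (2 ^ m + i) ≡ truncPattern m i
    per i = cong (_<ᵇ trunc d m) ([2^n+m]%2^n≡m%2^n i m)
    first-period : ∀ {x} → x ≤ 2 ^ m → count1 (truncPattern m) x ≡ x ⊓ trunc d m
    first-period {x} x≤2^m = trans (count1-cong x (λ i i<x → cong (_<ᵇ trunc d m) (m<2^n⇒m%2^n≡m m (<-≤-trans i<x x≤2^m))))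
                                   (count1-<ᵇ (trunc d m) x)

  truncPattern-lower : ∀ {k m} → k ≤ m → ∀ c r → r ≤ 2 ^ m →
    trunc d k * (c * 2 ^ m + r) ≤ count1 (truncPattern m) (c * 2 ^ m + r) * 2 ^ k
  truncPattern-lower {k} {m} k≤m c r r≤2^m rewrite count1-truncPattern m c r r≤2^m = begin
    t * (c * p + r)               ≡⟨ distrib t c p r ⟩
    c * (t * p) + t * r           ≤⟨ +-mono-≤ (*-monoʳ-≤ c (trunc-ratio-lower k≤m)) remainder ⟩
    c * (T′ * q) + (r ⊓ T′) * q   ≡⟨ collect c T′ q (r ⊓ T′) ⟩
    (c * T′ + r ⊓ T′) * q         ∎
    where
    open ≤-Reasoning
    t T′ q p : ℕ
    t = trunc d k
    T′ = trunc d m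
    q = 2 ^ k
    p = 2 ^ m
    remainder : t * r ≤ (r ⊓ T′) * q
    remainder with r ≤? T′
    ... | yes r≤T′ rewrite m≤n⇒m⊓n≡m r≤T′ = ≤-trans (*-monoˡ-≤ r (<⇒≤ (trunc<2^ k))) (≤-reflexive (*-comm q r))
    ... | no  r≰T′ rewrite m≥n⇒m⊓n≡n (<⇒≤ (≰⇒> r≰T′)) = ≤-trans (*-monoʳ-≤ t r≤2^m) (trunc-ratio-lower k≤m)
    distrib : ∀ t c p r → t * (c * p + r) ≡ c * (t * p) + t * r
    distrib = solve-∀
    collect : ∀ c T q u → c * (T * q) + u * q ≡ (c * T + u) * q
    collect = solve-∀

  truncPattern-upper : ∀ {k m} → k ≤ m → ∀ c r → r ≤ 2 ^ m →
    count1 (truncPattern m) (c * 2 ^ m + r) * 2 ^ k ≤ suc (trunc d k) * (c * 2 ^ m + r) + 2 ^ k * 2 ^ m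
  truncPattern-upper {k} {m} k≤m c r r≤2^m rewrite count1-truncPattern m c r r≤2^m = begin
    (c * T′ + r ⊓ T′) * q         ≡⟨ distrib c T′ q (r ⊓ T′) ⟩
    c * (T′ * q) + (r ⊓ T′) * q   ≤⟨ +-mono-≤ (*-monoʳ-≤ c (trunc-ratio-upper k≤m))
                                              (≤-trans (*-monoˡ-≤ q (≤-trans (m⊓n≤m r T′) r≤2^m)) (≤-reflexive (*-comm p q))) ⟩
    c * (suc t * p) + q * p       ≡⟨ cong (_+ q * p) (x*[y*z]≡y*[x*z] c (suc t) p) ⟩
    suc t * (c * p) + q * p       ≤⟨ +-monoˡ-≤ (q * p) (*-monoʳ-≤ (suc t) (m≤m+n (c * p) r)) ⟩
    suc t * (c * p + r) + q * p   ∎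
    where
    open ≤-Reasoning
    t T′ q p : ℕ
    t = trunc d k
    T′ = trunc d m
    q = 2 ^ k
    p = 2 ^ m
    distrib : ∀ c T q u → (c * T + u) * q ≡ c * (T * q) + u * q
    distrib = solve-∀
    x*[y*z]≡y*[x*z] : ∀ x y z → x * (y * z) ≡ y * (x * z)
    x*[y*z]≡y*[x*z] = solve-∀

  truncPattern-density : ∀ {k m} → k ≤ m → DensityBounds (trunc d k) (2 ^ k) (2 ^ k * 2 ^ m) (truncPattern m)
  truncPattern-density {k} {m} k≤m x =
    subst (λ x → trunc d k * x ≤ count1 (truncPattern m) x * 2 ^ k ×
                 count1 (truncPattern m) x * 2 ^ k ≤ suc (trunc d k) * x + 2 ^ k * 2 ^ m)
      (sym (trans (m≡m%2^n+[m/2^n]*2^n x m) (+-comm (x %2^ m) _)))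
      (truncPattern-lower k≤m (x /2^ m) (x %2^ m) r≤2^m , truncPattern-upper k≤m (x /2^ m) (x %2^ m) r≤2^m)
    where
    r≤2^m : x %2^ m ≤ 2 ^ m
    r≤2^m = <⇒≤ (m%2^n<2^n x m)

  truncPattern-double : ∀ m j e → e < 2 → j %2^ m ≢ trunc d m → truncPattern (suc m) (2 * j + e) ≡ truncPattern m j
  truncPattern-double m j e e<2 off = trans (cong (_<ᵇ trunc d (suc m)) ([2*m+e]%2^[1+n] j m e e<2))
    (<ᵇ-double (j %2^ m) (trunc d m) e (bit (d m)) off e<2 (s≤s (bit≤1 (d m))))

  block : ℕ → ℕ → Bool
  block L = splice (switchPoint L) (truncPattern (patternExp L)) (truncPattern (suc (patternExp L)))

  seq : Seq
  seq = dyadicConcat block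

  block≡truncPattern-exponentAt : ∀ L j → block L j ≡ truncPattern (exponentAt L j) j
  block≡truncPattern-exponentAt L j = sym (if-float (λ m → truncPattern m j) (j <ᵇ switchPoint L))

  onResidue : ℕ → ℕ → Bool
  onResidue m j = j %2^ m ≡ᵇ trunc d m

  SwitchOrResidue : ℕ → ℕ → Bool
  SwitchOrResidue L j = switchWindow L j ∨ (onResidue (patternExp L) j ∨ onResidue (suc (patternExp L)) j)

  block-double : ∀ L {j e} → 3 ≤ slack L → e < 2 → j < 2 ^ L →
    T (block (suc L) (2 * j + e) xor block L j) → T (SwitchOrResidue L j)
  block-double L {j} {e} 3≤K e<2 j<2^L differ = classify (j <? P) (P + W ≤? j)
    where
    to-∨ : ∀ {x y} → T x ⊎ T y → T (x ∨ y)
    to-∨ = Equivalence.from T-∨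
    M P W m : ℕ
    M = patternExp L
    P = switchPoint L
    W = 2 ^ suc M
    m = exponentAt L j
    off-residue : j < P ⊎ P + W ≤ j → T (onResidue m j)
    off-residue outside with j %2^ m ≟ trunc d m
    ... | yes on  = ≡⇒≡ᵇ _ _ on
    ... | no  off = ⊥-elim (subst T (trans (cong (_xor block L j) agree) (xor-same (block L j))) differ)
      where
      agree : block (suc L) (2 * j + e) ≡ block L j
      agree = begin
        block (suc L) (2 * j + e)                                  ≡⟨ block≡truncPattern-exponentAt (suc L) (2 * j + e) ⟩
        truncPattern (exponentAt (suc L) (2 * j + e)) (2 * j + e)  ≡⟨ cong (λ m′ → truncPattern m′ (2 * j + e))
                                                                             (exponentAt-suc L 3≤K e<2 j<2^L outside) ⟩
        truncPattern (suc m) (2 * j + e)                           ≡⟨ truncPattern-double m j e e<2 off ⟩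
        truncPattern m j                                           ≡⟨ sym (block≡truncPattern-exponentAt L j) ⟩
        block L j                                                  ∎
        where open ≡-Reasoning
    residue-exponent : T (onResidue m j) → T (onResidue M j ∨ onResidue (suc M) j)
    residue-exponent on with j <? P
    ... | yes j<P = to-∨ {y = onResidue (suc M) j}
                      (inj₁ (subst (λ m′ → T (onResidue m′ j)) (splice-< P (λ _ → M) (λ _ → suc M) j<P) on))
    ... | no  j≮P = to-∨ {onResidue M j}
                      (inj₂ (subst (λ m′ → T (onResidue m′ j)) (splice-≥ P (λ _ → M) (λ _ → suc M) (≮⇒≥ j≮P)) on))
    classify : Dec (j < P) → Dec (P + W ≤ j) → T (SwitchOrResidue L j)
    classify (yes j<P) _           = to-∨ {switchWindow L j} (inj₂ (residue-exponent (off-residue (inj₁ j<P))))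
    classify (no _)    (yes P+W≤j) = to-∨ {switchWindow L j} (inj₂ (residue-exponent (off-residue (inj₂ P+W≤j))))
    classify (no j≮P)  (no P+W≰j)  = to-∨ {y = onResidue M j ∨ onResidue (suc M) j}
                                       (inj₁ (Equivalence.from T-∧ (≤⇒≤ᵇ (≮⇒≥ j≮P) , <⇒<ᵇ (≰⇒> P+W≰j))))

  count1-SwitchOrResidue : ∀ L → 3 ≤ slack L →
    count1 (SwitchOrResidue L) (2 ^ L) ≤ 2 ^ suc (patternExp L) + (2 ^ suc (slack L) + 2 ^ slack L)
  count1-SwitchOrResidue L 3≤K = begin
    count1 (SwitchOrResidue L) (2 ^ L)                                        ≤⟨ count1-∨ (switchWindow L) _ (2 ^ L) ⟩
    count1 (switchWindow L) (2 ^ L) + count1 (λ j → onResidue M j ∨ onResidue (suc M) j) (2 ^ L)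
                                                                              ≤⟨ +-mono-≤ window (count1-∨ (onResidue M) (onResidue (suc M)) (2 ^ L)) ⟩
    W + (count1 (onResidue M) (2 ^ L) + count1 (onResidue (suc M)) (2 ^ L))  ≤⟨ +-monoʳ-≤ W (+-mono-≤ residue residue′) ⟩
    W + (2 ^ suc K + 2 ^ K)                                                   ∎
    where
    open ≤-Reasoning
    K M P W : ℕ
    K = slack L
    M = patternExp L
    P = switchPoint L
    W = 2 ^ suc M
    window : count1 (switchWindow L) (2 ^ L) ≤ W
    window = count1-window (switchWindow L) P W (2 ^ L) λ j inside →
      let P≤j , j<P+W = Equivalence.to T-∧ inside in ≤ᵇ⇒≤ P j P≤j , <ᵇ⇒< j (P + W) j<P+W
    residue : count1 (onResidue M) (2 ^ L) ≤ 2 ^ suc K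
    residue = subst (λ N → count1 (onResidue M) N ≤ 2 ^ suc K)
      (sym (trans (cong (2 ^_) (proj₁ (level-large L 3≤K))) (^-distribˡ-+-* 2 (suc K) M)))
      (count1-residue M (2 ^ suc K) (trunc d M))
    residue′ : count1 (onResidue (suc M)) (2 ^ L) ≤ 2 ^ K
    residue′ = subst (λ N → count1 (onResidue (suc M)) N ≤ 2 ^ K) (sym (2^L≡2^slack*2^[1+patternExp] L 3≤K))
      (count1-residue (suc M) (2 ^ K) (trunc d (suc M)))

  large-level : ∀ k L → 2 ^ (3 + k) ≤ L → 3 + k ≤ slack L
  large-level k L 2^[3+k]≤L = ⌊log₂⌋-≥ (m≤n⇒m≤1+n 2^[3+k]≤L)

  seq-double : ∀ L {j e} → e < 2 → j < 2 ^ L →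
    seq (2 * (2 ^ L + j) + e) xor seq (2 ^ L + j) ≡ block (suc L) (2 * j + e) xor block L j
  seq-double L {j} {e} e<2 j<2^L = cong₂ _xor_
    (trans (cong seq (regroup (2 ^ L) j e)) (dyadicConcat-block block (suc L) (2 * j + e) (2*m+e<2*n e<2 j<2^L)))
    (dyadicConcat-block block L j j<2^L)
    where
    regroup : ∀ p j e → 2 * (p + j) + e ≡ 2 * p + (2 * j + e)
    regroup = solve-∀

  seq-double-blocks : ∀ e → e < 2 → ∀ k L → 2 ^ (3 + k) ≤ L →
    count1 (λ j → seq (2 * (2 ^ L + j) + e) xor seq (2 ^ L + j)) (2 ^ L) * 2 ^ k ≤ 2 ^ L
  seq-double-blocks e e<2 k L 2^[3+k]≤L = begin
    count1 (λ j → seq (2 * (2 ^ L + j) + e) xor seq (2 ^ L + j)) (2 ^ L) * 2 ^ k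
      ≡⟨ cong (_* 2 ^ k) (count1-cong (2 ^ L) (λ j j<2^L → seq-double L e<2 j<2^L)) ⟩
    count1 (λ j → block (suc L) (2 * j + e) xor block L j) (2 ^ L) * 2 ^ k
      ≤⟨ *-monoˡ-≤ (2 ^ k) (count1-⇒ (2 ^ L) (λ j j<2^L → block-double L 3≤K e<2 j<2^L)) ⟩
    count1 (SwitchOrResidue L) (2 ^ L) * 2 ^ k
      ≤⟨ *-monoˡ-≤ (2 ^ k) (count1-SwitchOrResidue L 3≤K) ⟩
    (W + (2 ^ suc K + 2 ^ K)) * 2 ^ k
      ≤⟨ *-monoˡ-≤ (2 ^ k) (+-monoʳ-≤ W (+-mono-≤ (^-monoʳ-≤ 2 (s≤s K≤M)) (^-monoʳ-≤ 2 (m≤n⇒m≤1+n K≤M)))) ⟩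
    (W + (W + W)) * 2 ^ k
      ≤⟨ *-monoˡ-≤ (2 ^ k) (m≤m+n (W + (W + W)) W) ⟩
    (W + (W + W) + W) * 2 ^ k
      ≡⟨ regroup W (2 ^ k) ⟩
    2 ^ (2 + k) * W
      ≤⟨ *-monoˡ-≤ W (^-monoʳ-≤ 2 (≤-trans (n≤1+n (2 + k)) 3+k≤K)) ⟩
    2 ^ K * W
      ≡⟨ sym (2^L≡2^slack*2^[1+patternExp] L 3≤K) ⟩
    2 ^ L ∎
    where
    open ≤-Reasoning
    K M W : ℕ
    K = slack L
    M = patternExp L
    W = 2 ^ suc M
    3+k≤K : 3 + k ≤ K
    3+k≤K = large-level k L 2^[3+k]≤L
    3≤K : 3 ≤ K
    3≤K = ≤-trans (m≤m+n 3 k) 3+k≤K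
    K≤M : K ≤ M
    K≤M = proj₂ (level-large L 3≤K)
    regroup : ∀ W q → (W + (W + W) + W) * q ≡ 2 * (2 * q) * W
    regroup = solve-∀

  seq-self-similar : ∀ e → e < 2 → (λ n → seq (2 * n + e)) ≃ seq
  seq-self-similar e e<2 = negligible⇒≃ (negligible-dyadic _ λ k → 2 ^ (3 + k) , seq-double-blocks e e<2 k)

  blockError : ℕ → ℕ → ℕ
  blockError k L = 2 ^ k * 2 ^ patternExp L + 2 ^ k * 2 ^ suc (patternExp L)

  block-density : ∀ k L → 2 ^ (3 + k) ≤ L →
    DensityBounds (trunc d k) (2 ^ k) (blockError k L) (block L) × blockError k L * 4 ≤ 2 ^ L
  block-density k L 2^[3+k]≤L =
    splice-density {trunc d k} {2 ^ k} (switchPoint L) (truncPattern M) (truncPattern (suc M))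
      (truncPattern-periodic (suc M) (progress L)) (truncPattern-density k≤M) (truncPattern-density (m≤n⇒m≤1+n k≤M)) ,
    (begin
      (2 ^ k * 2 ^ M + 2 ^ k * W) * 4   ≤⟨ *-monoˡ-≤ 4 (+-monoˡ-≤ (2 ^ k * W) (*-monoʳ-≤ (2 ^ k) (^-monoʳ-≤ 2 (n≤1+n M)))) ⟩
      (2 ^ k * W + 2 ^ k * W) * 4       ≡⟨ regroup (2 ^ k) W ⟩
      2 ^ (3 + k) * W                   ≤⟨ *-monoˡ-≤ W (^-monoʳ-≤ 2 3+k≤K) ⟩
      2 ^ slack L * W                   ≡⟨ sym (2^L≡2^slack*2^[1+patternExp] L 3≤K) ⟩
      2 ^ L                             ∎)
    where
    open ≤-Reasoning
    M W : ℕ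
    M = patternExp L
    W = 2 ^ suc M
    3+k≤K : 3 + k ≤ slack L
    3+k≤K = large-level k L 2^[3+k]≤L
    3≤K : 3 ≤ slack L
    3≤K = ≤-trans (m≤m+n 3 k) 3+k≤K
    k≤M : k ≤ M
    k≤M = ≤-trans (≤-trans (m≤n+m k 3) 3+k≤K) (proj₂ (level-large L 3≤K))
    regroup : ∀ q W → (q * W + q * W) * 4 ≡ 2 * (2 * (2 * q)) * W
    regroup = solve-∀

  seq-frequency : FreqOneEq seq d
  seq-frequency k = DyadicFrequency.frequency block (trunc d k) (2 ^ k) {{m^n≢0 2 k}} (2 ^ (3 + k)) (blockError k)
    (<⇒≤ (trunc<2^ k)) (block-density k)

proposition4p3 : (d : ℕ → Bool) → Σ Seq (λ a → AsympAutomatic2 a × FreqOneEq a d)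
proposition4p3 d = seq d , self-similar⇒asympAutomatic2 (seq d) (seq-self-similar d) , seq-frequency d
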